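{- Let $A$ be a cyclic permutation group on a finite set whose order is a prime power. Then $A \in GR$ if and only if $A$ has at least two orbits of cardinality greater than $2$ or $A$ has order $2$.
   Context: A cyclic permutation group is a permutation group generated by a single permutation; its order is the number of its elements. A $k$-colored graph $G=(V,E)$ consists of a finite set $V$ and a function $E$ from the 2-element subsets of $V$ to $\{0,\ldots,k-1\}$. An automorphism of $G$ is a permutation of $V$ preserving $E$; $Aut(G)$ is the automorphism group as a permutation group on $V$. $GR$ is the class of permutation groups $(A,V)$ with $A=Aut(G)$ for some $k$-colored graph $G$ on $V$, for some $k$. -}

module Defs where

open import Data.Nat using (ℕ; zero; suc; _<_; _≤_)
open import Data.Fin using (Fin)
open import Data.Fin.Permutation using (Permutation′; _⟨$⟩ʳ_)
open import Data.Product using (Σ; ∃; _×_)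
open import Relation.Binary.PropositionalEquality using (_≡_; _≢_)
open import Relation.Nullary using (¬_)
open import Function.Bundles using (_⇔_)

pow : ∀ {n} → Permutation′ n → ℕ → Fin n → Fin n
pow σ zero    x = x
pow σ (suc i) x = σ ⟨$⟩ʳ (pow σ i x)

_∈⟨_⟩ : ∀ {n} → Permutation′ n → Permutation′ n → Set
π ∈⟨ σ ⟩ = ∃ λ i → ∀ x → π ⟨$⟩ʳ x ≡ pow σ i x

-- the order of the cyclic group ⟨σ⟩ is m (= order of the generator σ)
GroupOrder : ∀ {n} → Permutation′ n → ℕ → Set
GroupOrder σ m =
  0 < m × (∀ x → pow σ m x ≡ x) × (∀ j → 0 < j → j < m → ¬ (∀ x → pow σ j x ≡ x))

-- k-colored graph on Fin n: colour of an unordered pair {x,y}, x ≠ y,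
-- represented by a symmetric function (values on the diagonal are irrelevant)
record ColoredGraph (n k : ℕ) : Set where
  field
    col : Fin n → Fin n → Fin k
    sym : ∀ x y → col x y ≡ col y x

IsAut : ∀ {n k} → ColoredGraph n k → Permutation′ n → Set
IsAut G π = ∀ x y → x ≢ y →
  ColoredGraph.col G (π ⟨$⟩ʳ x) (π ⟨$⟩ʳ y) ≡ ColoredGraph.col G x y

-- ⟨σ⟩ ∈ GR : ⟨σ⟩ = Aut(G) for some k-colored graph G on Fin n
InGR : ∀ {n} → Permutation′ n → Set
InGR {n} σ = ∃ λ k → Σ (ColoredGraph n k) λ G →
  ∀ (π : Permutation′ n) → (π ∈⟨ σ ⟩ ⇔ IsAut G π)

InOrbit : ∀ {n} → Permutation′ n → Fin n → Fin n → Set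
InOrbit σ x y = ∃ λ i → pow σ i x ≡ y

BigOrbit : ∀ {n} → Permutation′ n → Fin n → Set
BigOrbit σ x = ∃ λ a → ∃ λ b → ∃ λ c →
  InOrbit σ x a × InOrbit σ x b × InOrbit σ x c × a ≢ b × a ≢ c × b ≢ c

TwoBigOrbits : ∀ {n} → Permutation′ n → Set
TwoBigOrbits σ = ∃ λ x → ∃ λ y →
  ¬ InOrbit σ x y × BigOrbit σ x × BigOrbit σ y

-- Three facts carry the proof.
--   Regular orbit.  Some point z has trivial stabiliser in ⟨σ⟩: take z moved by
--     σ^(pᵏ⁻¹); an exponent fixing z has gcd with m fixing z, and a proper divisor
--     of pᵏ divides pᵏ⁻¹ (regular-orbit).
--   Rigidity.  Colour each pair {x,y} by its ⟨σ⟩-orbit (its orbital).  If m = 2,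
--     or σ² ≠ id and some point c outside the orbit of z has σ²c ≠ c, every map
--     preserving orbitals is a power of σ (Rigidity.rigidity), so ⟨σ⟩ is the
--     automorphism group of this orbital graph (orbitalGraph-GR).
--   Reflection.  If σ² ≠ id but σ² fixes every point outside the orbit of z, the
--     map σⁱz ↦ σ⁻ⁱz (identity elsewhere) preserves every σ-invariant colouring
--     but is not a power of σ (not-GR).
-- Orbits with more than two points are exactly those on which σ² ≠ id, which
-- turns these facts into the stated criterion.

module Submission where

open import Defs
open import Data.Nat as ℕ using (ℕ; zero; suc; _+_; _*_; _^_; _≤_; NonZero)
open import Data.Nat.Properties using (n<1+n; +-comm; *-comm; *-zeroʳ; *-identityˡ; *-identityʳ; suc-injective; ≤∧≢⇒<; m^n>0; ^-monoʳ-<)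
open import Data.Nat.DivMod using (_%_; _/_; m≡m%n+[m/n]*n; m%n<n)
open import Data.Nat.Divisibility using (_∣_; divides; _∣?_; *-cancelʳ-∣; *-monoˡ-∣; ∣1⇒≡1)
open import Data.Nat.GCD using (gcd; gcd[m,n]∣m; gcd[m,n]∣n; gcd-GCD; module Bézout)
open import Data.Nat.Coprimality using (Coprime; coprime-divisor)
open import Data.Nat.Primality using (Prime; prime⇒nonZero; prime⇒nonTrivial; prime⇒irreducible)
open import Data.Fin using (Fin; _<_; toℕ; fromℕ<; combine; remQuot)
open import Data.Fin.Properties using (_≟_; any?; ¬∀⟶∃¬; ¬∀⟶∃¬-smallest; <-cmp; toℕ-injective; toℕ-inject; toℕ-fromℕ<; remQuot-combine)
open import Data.Fin.Permutation using (Permutation′; _⟨$⟩ʳ_; _⟨$⟩ˡ_; inverseˡ; permutation)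
open import Data.Product using (Σ; ∃; _×_; _,_; proj₁; proj₂)
import Data.Product as Product
open import Data.Sum using (_⊎_; inj₁; inj₂)
import Data.Sum as Sum
open import Data.Empty using (⊥-elim)
open import Function using (_∘_; id)
open import Function.Bundles using (_⇔_; mk⇔; Equivalence)
open import Relation.Binary.Definitions using (tri<; tri≈; tri>)
open import Relation.Binary.Structures using (IsDecEquivalence)
open import Relation.Nullary using (¬_; Dec; yes; no)
open import Relation.Nullary.Decidable using (map′; ¬?; _×-dec_; _⊎-dec_; decidable-stable)
open import Relation.Binary.PropositionalEquality

pigeonhole₃ : ∀ {A : Set} {u v a b c : A} → a ≡ u ⊎ a ≡ v → b ≡ u ⊎ b ≡ v → c ≡ u ⊎ c ≡ v →
              a ≡ b ⊎ a ≡ c ⊎ b ≡ c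
pigeonhole₃ (inj₁ refl) (inj₁ refl) _           = inj₁ refl
pigeonhole₃ (inj₂ refl) (inj₂ refl) _           = inj₁ refl
pigeonhole₃ (inj₁ refl) (inj₂ _)    (inj₁ refl) = inj₂ (inj₁ refl)
pigeonhole₃ (inj₂ refl) (inj₁ _)    (inj₂ refl) = inj₂ (inj₁ refl)
pigeonhole₃ (inj₁ _)    (inj₂ refl) (inj₂ refl) = inj₂ (inj₂ refl)
pigeonhole₃ (inj₂ _)    (inj₁ refl) (inj₁ refl) = inj₂ (inj₂ refl)

module Action {n : ℕ} (σ : Permutation′ n) where
  open ≡-Reasoning

  infixr 5 _·_

  _·_ : ℕ → Fin n → Fin n
  i · x = pow σ i x

  ·-+ : ∀ i j x → (i + j) · x ≡ i · j · x
  ·-+ zero    j x = refl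
  ·-+ (suc i) j x = cong (σ ⟨$⟩ʳ_) (·-+ i j x)

  ·-comm : ∀ i j x → i · j · x ≡ j · i · x
  ·-comm i j x = begin
    i · j · x   ≡⟨ ·-+ i j x ⟨
    (i + j) · x ≡⟨ cong (_· x) (+-comm i j) ⟩
    (j + i) · x ≡⟨ ·-+ j i x ⟩
    j · i · x   ∎

  ·-injective : ∀ i {x y} → i · x ≡ i · y → x ≡ y
  ·-injective zero    eq = eq
  ·-injective (suc i) {x} {y} eq = ·-injective i (begin
    i · x                       ≡⟨ inverseˡ σ ⟨
    σ ⟨$⟩ˡ (σ ⟨$⟩ʳ (i · x))     ≡⟨ cong (σ ⟨$⟩ˡ_) eq ⟩
    σ ⟨$⟩ˡ (σ ⟨$⟩ʳ (i · y))     ≡⟨ inverseˡ σ ⟩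
    i · y                       ∎)

  ·-*-fix : ∀ {a x} → a · x ≡ x → ∀ c → (c * a) · x ≡ x
  ·-*-fix e zero = refl
  ·-*-fix {a} {x} e (suc c) = begin
    (a + c * a) · x ≡⟨ ·-+ a (c * a) x ⟩
    a · (c * a) · x ≡⟨ cong (a ·_) (·-*-fix e c) ⟩
    a · x           ≡⟨ e ⟩
    x               ∎

  IsAut-pow : ∀ {k} (G : ColoredGraph n k) → IsAut G σ →
              ∀ i x y → x ≢ y → ColoredGraph.col G (i · x) (i · y) ≡ ColoredGraph.col G x y
  IsAut-pow G inv zero    x y x≢y = refl
  IsAut-pow G inv (suc i) x y x≢y =
    trans (inv (i · x) (i · y) (x≢y ∘ ·-injective i)) (IsAut-pow G inv i x y x≢y)

  two-point-orbit : ∀ {x} → 2 · x ≡ x → ∀ i → i · x ≡ x ⊎ i · x ≡ 1 · x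
  two-point-orbit e zero = inj₁ refl
  two-point-orbit e (suc i) with two-point-orbit e i
  ... | inj₁ q = inj₂ (cong (1 ·_) q)
  ... | inj₂ q = inj₁ (trans (cong (1 ·_) q) e)

  bigOrbit⇒moved : ∀ {x} → BigOrbit σ x → 2 · x ≢ x
  bigOrbit⇒moved (a , b , c , (i , refl) , (j , refl) , (k , refl) , a≢b , a≢c , b≢c) e
    with pigeonhole₃ (two-point-orbit e i) (two-point-orbit e j) (two-point-orbit e k)
  ... | inj₁ eq        = a≢b eq
  ... | inj₂ (inj₁ eq) = a≢c eq
  ... | inj₂ (inj₂ eq) = b≢c eq

  moved⇒bigOrbit : ∀ {x} → 2 · x ≢ x → BigOrbit σ x
  moved⇒bigOrbit {x} moved =
    x , 1 · x , 2 · x , (0 , refl) , (1 , refl) , (2 , refl) , x≢σx , moved ∘ sym , σx≢σ²x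
    where
    x≢σx : x ≢ 1 · x
    x≢σx e = moved (trans (cong (1 ·_) (sym e)) (sym e))
    σx≢σ²x : 1 · x ≢ 2 · x
    σx≢σ²x e = x≢σx (·-injective 1 e)

-- A decidable equivalence on Fin N has a complete invariant: the least member of
-- each class.  This is how orbitals of pairs are turned into finitely many colours.
module Canonical {N : ℕ} {_~_ : Fin N → Fin N → Set} (isDecEq : IsDecEquivalence _~_) where
  open IsDecEquivalence isDecEq using () renaming (_≟_ to _~?_; refl to ~-refl; sym to ~-sym; trans to ~-trans)

  least : ∀ x → ∃ λ c → c ~ x × (∀ j → j < c → ¬ j ~ x)
  least x with ¬∀⟶∃¬-smallest N (λ c → ¬ c ~ x) (λ c → ¬? (c ~? x)) (λ none → none x ~-refl)
  ... | c , ¬¬c~x , below = c , decidable-stable (c ~? x) ¬¬c~x , λ j j<c →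
    subst (λ i → ¬ i ~ x) (toℕ-injective (trans (toℕ-inject _) (toℕ-fromℕ< j<c))) (below (fromℕ< j<c))

  canon : Fin N → Fin N
  canon x = proj₁ (least x)

  canon-~ : ∀ x → canon x ~ x
  canon-~ x = proj₁ (proj₂ (least x))

  -- related points share their representative: neither can lie below the other
  canon-resp : ∀ {x y} → x ~ y → canon x ≡ canon y
  canon-resp {x} {y} x~y with <-cmp (canon x) (canon y)
  ... | tri< lt _ _ = ⊥-elim (proj₂ (proj₂ (least y)) (canon x) lt (~-trans (canon-~ x) x~y))
  ... | tri≈ _ eq _ = eq
  ... | tri> _ _ gt = ⊥-elim (proj₂ (proj₂ (least x)) (canon y) gt (~-trans (canon-~ y) (~-sym x~y)))

  canon-complete : ∀ {x y} → canon x ≡ canon y → x ~ y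
  canon-complete {x} {y} eq = ~-trans (~-sym (canon-~ x)) (subst (_~ y) (sym eq) (canon-~ y))

module Periodic {n : ℕ} (σ : Permutation′ n) (m′ : ℕ) (period : ∀ x → pow σ (suc m′) x ≡ x) where
  open Action σ
  open ≡-Reasoning

  m : ℕ
  m = suc m′

  -- the exponent m′ * i acts as σ⁻ⁱ
  neg : ℕ → ℕ
  neg i = m′ * i

  ·-neg-r : ∀ i x → i · neg i · x ≡ x
  ·-neg-r i x = begin
    i · neg i · x    ≡⟨ ·-+ i (neg i) x ⟨
    (m * i) · x      ≡⟨ cong (_· x) (*-comm m i) ⟩
    (i * m) · x      ≡⟨ ·-*-fix (period x) i ⟩
    x                ∎

  ·-neg-l : ∀ i x → neg i · i · x ≡ x
  ·-neg-l i x = trans (·-comm (neg i) i x) (·-neg-r i x)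

  ·-neg-cong : ∀ {i j x} → i · x ≡ j · x → neg i · x ≡ neg j · x
  ·-neg-cong {i} {j} {x} eq = begin
    neg i · x                 ≡⟨ cong (neg i ·_) (·-neg-l j x) ⟨
    neg i · neg j · j · x     ≡⟨ cong (λ y → neg i · neg j · y) eq ⟨
    neg i · neg j · i · x     ≡⟨ ·-comm (neg i) (neg j) (i · x) ⟩
    neg j · neg i · i · x     ≡⟨ cong (neg j ·_) (·-neg-l i x) ⟩
    neg j · x                 ∎

  ·-mod : ∀ i → Σ (Fin m) λ r → ∀ x → i · x ≡ toℕ r · x
  ·-mod i = fromℕ< (m%n<n i m) , λ x → begin
    i · x                           ≡⟨ cong (_· x) (m≡m%n+[m/n]*n i m) ⟩
    (i % m + i / m * m) · x         ≡⟨ ·-+ (i % m) (i / m * m) x ⟩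
    (i % m) · (i / m * m) · x       ≡⟨ cong ((i % m) ·_) (·-*-fix (period x) (i / m)) ⟩
    (i % m) · x                     ≡⟨ cong (_· x) (toℕ-fromℕ< (m%n<n i m)) ⟨
    toℕ (fromℕ< (m%n<n i m)) · x    ∎

  inOrbit? : ∀ x y → Dec (InOrbit σ x y)
  inOrbit? x y = map′ (λ (r , e) → toℕ r , e) reduce (any? λ r → toℕ r · x ≟ y)
    where
    reduce : InOrbit σ x y → ∃ λ (r : Fin m) → toℕ r · x ≡ y
    reduce (i , e) = proj₁ (·-mod i) , trans (sym (proj₂ (·-mod i) x)) e

  orbit-sym : ∀ {x y} → InOrbit σ x y → InOrbit σ y x
  orbit-sym {x} (i , refl) = neg i , ·-neg-l i x

  orbit-trans : ∀ {x y w} → InOrbit σ x y → InOrbit σ y w → InOrbit σ x w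
  orbit-trans {x} (i , refl) (j , refl) = j + i , ·-+ j i x

  Orbital : Fin n × Fin n → Fin n × Fin n → Set
  Orbital (x , y) (a , b) = ∃ λ j → (j · x ≡ a × j · y ≡ b) ⊎ (j · x ≡ b × j · y ≡ a)

  orbital-shift : ∀ i x y → Orbital (x , y) (i · x , i · y)
  orbital-shift i x y = i , inj₁ (refl , refl)

  orbital-swap : ∀ x y → Orbital (x , y) (y , x)
  orbital-swap x y = 0 , inj₂ (refl , refl)

  orbital-refl : ∀ {p} → Orbital p p
  orbital-refl {x , y} = orbital-shift 0 x y

  orbital-sym : ∀ {p q} → Orbital p q → Orbital q p
  orbital-sym {x , y} (j , inj₁ (refl , refl)) = neg j , inj₁ (·-neg-l j x , ·-neg-l j y)
  orbital-sym {x , y} (j , inj₂ (refl , refl)) = neg j , inj₂ (·-neg-l j y , ·-neg-l j x)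

  orbital-trans : ∀ {p q r} → Orbital p q → Orbital q r → Orbital p r
  orbital-trans {x , y} (i , inj₁ (refl , refl)) (j , inj₁ (refl , refl)) = j + i , inj₁ (·-+ j i x , ·-+ j i y)
  orbital-trans {x , y} (i , inj₁ (refl , refl)) (j , inj₂ (refl , refl)) = j + i , inj₂ (·-+ j i x , ·-+ j i y)
  orbital-trans {x , y} (i , inj₂ (refl , refl)) (j , inj₁ (refl , refl)) = j + i , inj₂ (·-+ j i x , ·-+ j i y)
  orbital-trans {x , y} (i , inj₂ (refl , refl)) (j , inj₂ (refl , refl)) = j + i , inj₁ (·-+ j i x , ·-+ j i y)

  orbital? : ∀ p q → Dec (Orbital p q)
  orbital? (x , y) (a , b) = map′ (λ (r , h) → toℕ r , h) reduce (any? (λ r → matches? (toℕ r)))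
    where
    matches? : ∀ j → Dec ((j · x ≡ a × j · y ≡ b) ⊎ (j · x ≡ b × j · y ≡ a))
    matches? j = ((j · x ≟ a) ×-dec (j · y ≟ b)) ⊎-dec ((j · x ≟ b) ×-dec (j · y ≟ a))
    reduce : Orbital (x , y) (a , b) → ∃ λ (r : Fin m) → (toℕ r · x ≡ a × toℕ r · y ≡ b) ⊎ (toℕ r · x ≡ b × toℕ r · y ≡ a)
    reduce (j , h) with ·-mod j
    ... | r , e = r , Sum.map (Product.map (trans (sym (e x))) (trans (sym (e y))))
                              (Product.map (trans (sym (e x))) (trans (sym (e y)))) h

  -- the orbital graph: pairs are coded in Fin (n * n), each coloured by the
  -- canonical code of its orbital
  private
    SameOrbital : Fin (n * n) → Fin (n * n) → Set
    SameOrbital c d = Orbital (remQuot n c) (remQuot n d)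

    sameOrbital-isDecEquivalence : IsDecEquivalence SameOrbital
    sameOrbital-isDecEquivalence = record
      { isEquivalence = record { refl = orbital-refl ; sym = orbital-sym ; trans = orbital-trans }
      ; _≟_ = λ c d → orbital? (remQuot n c) (remQuot n d) }

    open Canonical sameOrbital-isDecEquivalence

    decode : ∀ {x y a b} → SameOrbital (combine x y) (combine a b) ≡ Orbital (x , y) (a , b)
    decode {x} {y} {a} {b} = cong₂ Orbital (remQuot-combine x y) (remQuot-combine a b)

  colour : Fin n → Fin n → Fin (n * n)
  colour x y = canon (combine x y)

  colour-resp : ∀ {x y a b} → Orbital (x , y) (a , b) → colour x y ≡ colour a b
  colour-resp o = canon-resp (subst id (sym decode) o)

  colour-complete : ∀ {x y a b} → colour x y ≡ colour a b → Orbital (x , y) (a , b)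
  colour-complete eq = subst id decode (canon-complete eq)

  orbitalGraph : ColoredGraph n (n * n)
  orbitalGraph = record { col = colour ; sym = λ x y → colour-resp (orbital-swap x y) }

  orbitalGraph-invariant : ∀ i x y → colour (i · x) (i · y) ≡ colour x y
  orbitalGraph-invariant i x y = colour-resp (orbital-sym (orbital-shift i x y))

  Regular : Fin n → Set
  Regular z = ∀ i → i · z ≡ z → ∀ x → i · x ≡ x

  PreservesOrbitals : (Fin n → Fin n) → Set
  PreservesOrbitals f = ∀ x y → x ≢ y → Orbital (x , y) (f x , f y)

  RigidityCondition : Fin n → Set
  RigidityCondition z = m ≡ 2 ⊎ (2 · z ≢ z × ∃ λ c → ¬ InOrbit σ z c × 2 · c ≢ c)

  module Rigidity {z : Fin n} (regular : Regular z) where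

    Reflected : (Fin n → Fin n) → Fin n → Set
    Reflected ρ w = ∃ λ j → j · w ≡ z × j · z ≡ ρ w

    -- the pair {z, w} forces ρ to fix w or reflect it through z
    fixed-or-reflected : ∀ {ρ} → PreservesOrbitals ρ → ρ z ≡ z →
                         ∀ w → w ≢ z → ρ w ≡ w ⊎ Reflected ρ w
    fixed-or-reflected pres ρz w w≢z with pres z w (w≢z ∘ sym)
    ... | j , inj₁ (jz , jw) = inj₁ (trans (sym jw) (regular j (trans jz ρz) w))
    ... | j , inj₂ (jz , jw) = inj₂ (j , trans jw ρz , jz)

    -- for m = 2 reflection through z is trivial, since σ⁻ʲ = σʲ
    reflected-involution : ∀ {ρ w} → m ≡ 2 → Reflected ρ w → ρ w ≡ w
    reflected-involution {ρ} {w} m≡2 (j , jw , jz) = begin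
      ρ w            ≡⟨ jz ⟨
      j · z          ≡⟨ cong (_· z) (*-identityˡ j) ⟨
      (1 * j) · z    ≡⟨ cong (λ k → (k * j) · z) (suc-injective m≡2) ⟨
      (m′ * j) · z   ≡⟨ cong (neg j ·_) jw ⟨
      neg j · j · w  ≡⟨ ·-neg-l j w ⟩
      w              ∎

    -- a point c outside the orbit of z moved by σ² excludes nontrivial reflections
    module Witness {c : Fin n} (σ²z : 2 · z ≢ z) (c-outside : ¬ InOrbit σ z c) (σ²c : 2 · c ≢ c)
                   {ρ : Fin n → Fin n} (pres : PreservesOrbitals ρ) (ρz : ρ z ≡ z) where

      σz≢z : 1 · z ≢ z
      σz≢z e = σ²z (trans (cong (1 ·_) e) e)

      ρc : ρ c ≡ c
      ρc with fixed-or-reflected pres ρz c (λ { refl → c-outside (0 , refl) })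
      ... | inj₁ fixed = fixed
      ... | inj₂ (j , jc , _) = ⊥-elim (c-outside (orbit-sym (j , jc)))

      -- the pair {c, σz} rules out reflecting σz to σ⁻¹z
      ρσz : ρ (1 · z) ≡ 1 · z
      ρσz with fixed-or-reflected pres ρz (1 · z) σz≢z
      ... | inj₁ fixed = fixed
      ... | inj₂ (j , jσz , jz) with pres c (1 · z) (λ e → c-outside (1 , sym e))
      ...   | i , inj₂ (_ , iσz) = ⊥-elim (c-outside (i + 1 , trans (·-+ i 1 z) (trans iσz ρc)))
      ...   | i , inj₁ (ic , iσz) = ⊥-elim (σ²c (begin
            2 · c            ≡⟨ cong (2 ·_) (trans ic ρc) ⟨
            2 · i · c        ≡⟨ ·-+ 2 i c ⟨
            (2 + i) · c      ≡⟨ regular (2 + i) σ²⁺ⁱz c ⟩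
            c                ∎))
        where
        σ²⁺ⁱz : (2 + i) · z ≡ z
        σ²⁺ⁱz = begin
          1 · 1 · i · z    ≡⟨ cong (1 ·_) (·-comm 1 i z) ⟩
          1 · i · 1 · z    ≡⟨ cong (1 ·_) (trans iσz (sym jz)) ⟩
          1 · j · z        ≡⟨ ·-comm 1 j z ⟩
          j · 1 · z        ≡⟨ jσz ⟩
          z                ∎

      -- with σz fixed, the pair {σz, w} rules out any reflection
      reflected-witness : ∀ {w} → Reflected ρ w → ρ w ≡ w
      reflected-witness {w} (j , jw , jz) with w ≟ 1 · z
      ... | yes refl = ρσz
      ... | no w≢σz with pres (1 · z) w (w≢σz ∘ sym)
      ...   | i , inj₁ (iσz , iw) = trans (sym iw) (regular i (·-injective 1 iz) w)
        where
        iz : 1 · i · z ≡ 1 · z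
        iz = trans (·-comm 1 i z) (trans iσz ρσz)
      ...   | i , inj₂ (iσz , iw) = ⊥-elim (σ²z (·-injective j (begin
            j · 2 · z        ≡⟨ ·-comm j 2 z ⟩
            2 · j · z        ≡⟨ cong (2 ·_) jz ⟩
            2 · ρ w          ≡⟨ cong (1 ·_) iz ⟨
            1 · i · z        ≡⟨ ·-comm 1 i z ⟩
            i · 1 · z        ≡⟨ iσz ⟩
            ρ w              ≡⟨ jz ⟨
            j · z            ∎)))
        where
        iz : i · z ≡ 1 · ρ w
        iz = begin
          i · z            ≡⟨ cong (i ·_) jw ⟨
          i · j · w        ≡⟨ ·-comm i j w ⟩
          j · i · w        ≡⟨ cong (j ·_) (trans iw ρσz) ⟩
          j · 1 · z        ≡⟨ ·-comm j 1 z ⟩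
          1 · j · z        ≡⟨ cong (1 ·_) jz ⟩
          1 · ρ w          ∎

    fixes-all : RigidityCondition z → ∀ {ρ} → PreservesOrbitals ρ → ρ z ≡ z → ∀ w → ρ w ≡ w
    fixes-all cond {ρ} pres ρz w with w ≟ z
    ... | yes refl = ρz
    ... | no w≢z with fixed-or-reflected pres ρz w w≢z | cond
    ...   | inj₁ fixed     | _                              = fixed
    ...   | inj₂ reflected | inj₁ m≡2                       = reflected-involution {ρ} m≡2 reflected
    ...   | inj₂ reflected | inj₂ (σ²z , c , c-outside , σ²c) =
            Witness.reflected-witness σ²z c-outside σ²c pres ρz reflected

    -- every orbital-preserving map is a power of σ: normalise it to fix z
    rigidity : 1 · z ≢ z → RigidityCondition z → ∀ {f} → PreservesOrbitals f → ∃ λ t → ∀ x → f x ≡ t · x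
    rigidity σz≢z cond {f} pres with pres z (1 · z) (σz≢z ∘ sym)
    ... | j , h = t , λ x → begin
        f x                ≡⟨ ·-neg-r t (f x) ⟨
        t · neg t · f x    ≡⟨ cong (t ·_) (fixes-all cond pres′ ρz x) ⟩
        t · x              ∎
      where
      tz : ∃ λ t → t · z ≡ f z
      tz = Sum.[ (λ (jz , _) → j , jz) , (λ (_ , jσz) → suc j , trans (·-comm 1 j z) jσz) ] h
      t : ℕ
      t = proj₁ tz
      pres′ : PreservesOrbitals (λ x → neg t · f x)
      pres′ x y x≢y = orbital-trans (pres x y x≢y) (orbital-shift (neg t) (f x) (f y))
      ρz : neg t · f z ≡ z
      ρz = trans (cong (neg t ·_) (sym (proj₂ tz))) (·-neg-l t z)

  module Reflection (z : Fin n) where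

    reflect : ∀ y → Dec (InOrbit σ z y) → Fin n
    reflect y (yes (i , _)) = neg i · z
    reflect y (no _)        = y

    τ : Fin n → Fin n
    τ y = reflect y (inOrbit? z y)

    τ-outside : ∀ {y} → ¬ InOrbit σ z y → τ y ≡ y
    τ-outside {y} y∉ with inOrbit? z y
    ... | yes y∈ = ⊥-elim (y∉ y∈)
    ... | no _   = refl

    τ-orbit : ∀ i {y} → i · z ≡ y → τ y ≡ neg i · z
    τ-orbit i {y} iz with inOrbit? z y
    ... | yes (i′ , i′z) = ·-neg-cong (trans i′z (sym iz))
    ... | no y∉          = ⊥-elim (y∉ (i , iz))

    τ-involutive : ∀ y → τ (τ y) ≡ y
    τ-involutive y with inOrbit? z y
    ... | yes (i , refl) = trans (τ-orbit (neg i) refl) (begin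
          neg (neg i) · z              ≡⟨ cong (neg (neg i) ·_) (·-neg-l i z) ⟨
          neg (neg i) · neg i · i · z  ≡⟨ ·-neg-l (neg i) (i · z) ⟩
          i · z                        ∎)
    ... | no y∉          = τ-outside y∉

    τP : Permutation′ n
    τP = permutation τ τ τ-involutive τ-involutive

    -- if σ² fixes every point outside the orbit of z, τ preserves every
    -- σ-invariant colouring: on each pair it acts like a suitable power of σ
    module Preserves {k} (G : ColoredGraph n k) (invariant : IsAut G σ)
                     (outside-involutive : ∀ y → ¬ InOrbit σ z y → 2 · y ≡ y) where
      open ColoredGraph G using (col) renaming (sym to col-sym)

      τ-injective : ∀ {x y} → τ x ≡ τ y → x ≡ y
      τ-injective {x} {y} e = trans (sym (τ-involutive x)) (trans (cong τ e) (τ-involutive y))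

      -- both points in the orbit: σ^(i+j) maps {σ⁻ⁱz, σ⁻ʲz} to {σʲz, σⁱz}
      τ-orbit-orbit : ∀ i j → i · z ≢ j · z → col (τ (i · z)) (τ (j · z)) ≡ col (i · z) (j · z)
      τ-orbit-orbit i j ne = begin
        col (τ (i · z)) (τ (j · z))                       ≡⟨ cong₂ col (τ-orbit i refl) (τ-orbit j refl) ⟩
        col (neg i · z) (neg j · z)                       ≡⟨ IsAut-pow G invariant (i + j) _ _ reflected-distinct ⟨
        col ((i + j) · neg i · z) ((i + j) · neg j · z)   ≡⟨ cong₂ col shift-i shift-j ⟩
        col (j · z) (i · z)                               ≡⟨ col-sym (j · z) (i · z) ⟩
        col (i · z) (j · z)                               ∎
        where
        reflected-distinct : neg i · z ≢ neg j · z
        reflected-distinct e = ne (τ-injective (trans (τ-orbit i refl) (trans e (sym (τ-orbit j refl)))))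
        shift-i : (i + j) · neg i · z ≡ j · z
        shift-i = begin
          (i + j) · neg i · z  ≡⟨ cong (λ k → k · neg i · z) (+-comm i j) ⟩
          (j + i) · neg i · z  ≡⟨ ·-+ j i (neg i · z) ⟩
          j · i · neg i · z    ≡⟨ cong (j ·_) (·-neg-r i z) ⟩
          j · z                ∎
        shift-j : (i + j) · neg j · z ≡ i · z
        shift-j = trans (·-+ i j (neg j · z)) (cong (i ·_) (·-neg-r j z))

      -- one point in the orbit, one outside: σ^(2i) maps {σ⁻ⁱz, y} to {σⁱz, y}
      τ-orbit-outside : ∀ i {y} → i · z ≢ y → ¬ InOrbit σ z y → col (τ (i · z)) (τ y) ≡ col (i · z) y
      τ-orbit-outside i {y} ne y∉ = begin
        col (τ (i · z)) (τ y)                 ≡⟨ cong₂ col (τ-orbit i refl) (τ-outside y∉) ⟩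
        col (neg i · z) y                     ≡⟨ IsAut-pow G invariant (2 * i) _ _ reflected-distinct ⟨
        col ((2 * i) · neg i · z) ((2 * i) · y) ≡⟨ cong₂ col shift-z shift-y ⟩
        col (i · z) y                         ∎
        where
        reflected-distinct : neg i · z ≢ y
        reflected-distinct e = ne (τ-injective (trans (τ-orbit i refl) (trans e (sym (τ-outside y∉)))))
        shift-z : (2 * i) · neg i · z ≡ i · z
        shift-z = begin
          (i + 1 * i) · neg i · z  ≡⟨ cong (λ k → (i + k) · neg i · z) (*-identityˡ i) ⟩
          (i + i) · neg i · z      ≡⟨ ·-+ i i (neg i · z) ⟩
          i · i · neg i · z        ≡⟨ cong (i ·_) (·-neg-r i z) ⟩
          i · z                    ∎
        shift-y : (2 * i) · y ≡ y
        shift-y = trans (cong (_· y) (*-comm 2 i)) (·-*-fix (outside-involutive y y∉) i)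

      τ-automorphism : IsAut G τP
      τ-automorphism x y x≢y = by-cases (inOrbit? z x) (inOrbit? z y)
        where
        by-cases : Dec (InOrbit σ z x) → Dec (InOrbit σ z y) → col (τ x) (τ y) ≡ col x y
        by-cases (yes (i , refl)) (yes (j , refl)) = τ-orbit-orbit i j x≢y
        by-cases (yes (i , refl)) (no y∉)          = τ-orbit-outside i x≢y y∉
        by-cases (no x∉)          (yes (j , refl)) = begin
          col (τ x) (τ (j · z))  ≡⟨ col-sym _ _ ⟩
          col (τ (j · z)) (τ x)  ≡⟨ τ-orbit-outside j (x≢y ∘ sym) x∉ ⟩
          col (j · z) x          ≡⟨ col-sym _ _ ⟩
          col x (j · z)          ∎
        by-cases (no x∉)          (no y∉)          = cong₂ col (τ-outside x∉) (τ-outside y∉)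

    -- τ fixes z but not σz, so it is no power of σ once σ² ≠ id
    τ-not-power : Regular z → 2 · z ≢ z → ¬ τP ∈⟨ σ ⟩
    τ-not-power regular σ²z (i , τ≡σⁱ) = σ²z (begin
      1 · 1 · z        ≡⟨ cong (1 ·_) (trans (sym (regular i iz (1 · z))) (trans (sym (τ≡σⁱ (1 · z))) (τ-orbit 1 refl))) ⟩
      1 · neg 1 · z    ≡⟨ ·-neg-r 1 z ⟩
      z                ∎)
      where
      iz : i · z ≡ z
      iz = trans (sym (τ≡σⁱ z)) (trans (τ-orbit 0 refl) (cong (_· z) (*-zeroʳ m′)))

  orbitalGraph-GR : ∀ {z} → Regular z → 1 · z ≢ z → RigidityCondition z → InGR σ
  orbitalGraph-GR regular σz≢z cond = n * n , orbitalGraph , λ π → mk⇔ (power⇒aut π) (aut⇒power π)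
    where
    power⇒aut : ∀ π → π ∈⟨ σ ⟩ → IsAut orbitalGraph π
    power⇒aut π (i , π≡σⁱ) x y _ = trans (cong₂ colour (π≡σⁱ x) (π≡σⁱ y)) (orbitalGraph-invariant i x y)
    aut⇒power : ∀ π → IsAut orbitalGraph π → π ∈⟨ σ ⟩
    aut⇒power π aut = Rigidity.rigidity regular σz≢z cond (λ x y x≢y → colour-complete (sym (aut x y x≢y)))

  not-GR : ∀ {z} → Regular z → 2 · z ≢ z → (∀ y → ¬ InOrbit σ z y → 2 · y ≡ y) → ¬ InGR σ
  not-GR {z} regular σ²z outside-involutive (_ , G , aut⇔power) =
    τ-not-power regular σ²z (Equivalence.from (aut⇔power τP) (Preserves.τ-automorphism G σ-aut outside-involutive))
    where
    open Reflection z
    σ-aut : IsAut G σ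
    σ-aut = Equivalence.to (aut⇔power σ) (1 , λ x → refl)

  big-orbit-avoiding : TwoBigOrbits σ → ∀ z → ∃ λ c → ¬ InOrbit σ z c × 2 · c ≢ c
  big-orbit-avoiding (x , y , x↛y , big-x , big-y) z with inOrbit? z x
  ... | no x∉  = x , x∉ , bigOrbit⇒moved big-x
  ... | yes x∈ = y , (λ y∈ → x↛y (orbit-trans (orbit-sym x∈) y∈)) , bigOrbit⇒moved big-y

  criterion⇒rigidity : ∀ {z} → (m ≢ 2 → 2 · z ≢ z) → TwoBigOrbits σ ⊎ m ≡ 2 → RigidityCondition z
  criterion⇒rigidity σ²z≢z (inj₂ m≡2) = inj₁ m≡2
  criterion⇒rigidity {z} σ²z≢z (inj₁ two) with m ℕ.≟ 2
  ... | yes m≡2 = inj₁ m≡2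
  ... | no m≢2  = inj₂ (σ²z≢z m≢2 , big-orbit-avoiding two z)

  second-big-orbit? : ∀ z → 2 · z ≢ z → TwoBigOrbits σ ⊎ (∀ y → ¬ InOrbit σ z y → 2 · y ≡ y)
  second-big-orbit? z σ²z with any? (λ y → ¬? (inOrbit? z y) ×-dec ¬? (2 · y ≟ y))
  ... | yes (y , y∉ , σ²y) = inj₁ (z , y , y∉ , moved⇒bigOrbit σ²z , moved⇒bigOrbit σ²y)
  ... | no none            = inj₂ λ y y∉ → decidable-stable (2 · y ≟ y) (λ σ²y → none (y , y∉ , σ²y))

  fix-gcd : ∀ {i x} → i · x ≡ x → gcd i m · x ≡ x
  fix-gcd {i} {x} ix with Bézout.identity (gcd-GCD i m)
  ... | Bézout.Identity.+- a b eq = begin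
    gcd i m · x                   ≡⟨ cong (gcd i m ·_) (·-*-fix (period x) b) ⟨
    gcd i m · (b * m) · x         ≡⟨ ·-+ (gcd i m) (b * m) x ⟨
    (gcd i m + b * m) · x         ≡⟨ cong (_· x) eq ⟩
    (a * i) · x                   ≡⟨ ·-*-fix ix a ⟩
    x                             ∎
  ... | Bézout.Identity.-+ a b eq = begin
    gcd i m · x                   ≡⟨ cong (gcd i m ·_) (·-*-fix ix a) ⟨
    gcd i m · (a * i) · x         ≡⟨ ·-+ (gcd i m) (a * i) x ⟨
    (gcd i m + a * i) · x         ≡⟨ cong (_· x) eq ⟩
    (b * m) · x                   ≡⟨ ·-*-fix (period x) b ⟩
    x                             ∎

  regular-if : ∀ {q z} → (∀ {d} → d ∣ m → d ≢ m → d ∣ q) → q · z ≢ z → Regular z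
  regular-if {q} {z} proper q·z≢z i iz x with gcd i m ℕ.≟ m
  ... | yes g≡m with subst (_∣ i) g≡m (gcd[m,n]∣m i m)
  ...   | divides c refl = ·-*-fix (period x) c
  regular-if {q} {z} proper q·z≢z i iz x | no g≢m with proper (gcd[m,n]∣n i m) g≢m
  ...   | divides c refl = ⊥-elim (q·z≢z (·-*-fix (fix-gcd {i} iz) c))

cancel-factor : ∀ {p e} j .{{_ : NonZero p}} → e * p ∣ p ^ suc j → e ∣ p ^ j
cancel-factor {p} {e} j ep∣ = *-cancelʳ-∣ p (subst (e * p ∣_) (*-comm p (p ^ j)) ep∣)

prime-power-divisor : ∀ {p} → Prime p → ∀ j {d} → d ∣ p ^ suc j → d ≢ p ^ suc j → d ∣ p ^ j
prime-power-divisor {p} p-prime j {d} d∣ d≢ with p ∣? d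
... | no p∤d = coprime-divisor d-coprime-p d∣
  where
  d-coprime-p : Coprime d p
  d-coprime-p (c∣d , c∣p) with prime⇒irreducible p-prime c∣p
  ... | inj₁ c≡1  = c≡1
  ... | inj₂ refl = ⊥-elim (p∤d c∣d)
prime-power-divisor {p} p-prime zero {.(e * p)} d∣ d≢ | yes (divides e refl) =
  ⊥-elim (d≢ (trans (cong (_* p) (∣1⇒≡1 (cancel-factor {e = e} 0 d∣))) (trans (*-identityˡ p) (sym (*-identityʳ p)))))
  where instance _ = prime⇒nonZero p-prime
prime-power-divisor {p} p-prime (suc j) {.(e * p)} d∣ d≢ | yes (divides e refl) =
  subst (e * p ∣_) (*-comm (p ^ j) p) (*-monoˡ-∣ p e∣pʲ)
  where
  instance _ = prime⇒nonZero p-prime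
  e∣pʲ : e ∣ p ^ j
  e∣pʲ = prime-power-divisor p-prime j (cancel-factor {e = e} (suc j) d∣) (λ eq → d≢ (trans (cong (_* p) eq) (*-comm _ p)))

-- a cyclic group of prime-power order p^(j+1) has a regular orbit: any point
-- moved by σ^(p^j) will do
regular-orbit : ∀ {n} (σ : Permutation′ n) {m′ p} j (order : GroupOrder σ (suc m′)) →
                Prime p → suc m′ ≡ p ^ suc j → ∃ (Periodic.Regular σ m′ (proj₁ (proj₂ order)))
regular-orbit {n} σ {m′} {p} j (_ , period , minimal) p-prime m≡pᵏ =
  Product.map₂ (regular-if proper-divisor) moved-point
  where
  open Periodic σ m′ period
  instance
    _ = prime⇒nonZero p-prime
    _ = prime⇒nonTrivial p-prime
  σ^pʲ≢id : ¬ (∀ x → pow σ (p ^ j) x ≡ x)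
  σ^pʲ≢id = minimal (p ^ j) (m^n>0 p j)
    (subst (p ^ j ℕ.<_) (sym m≡pᵏ) (^-monoʳ-< p (ℕ.nonTrivial⇒n>1 p) (n<1+n j)))
  moved-point : ∃ λ z → pow σ (p ^ j) z ≢ z
  moved-point = ¬∀⟶∃¬ n (λ x → pow σ (p ^ j) x ≡ x) (λ x → pow σ (p ^ j) x ≟ x) σ^pʲ≢id
  proper-divisor : ∀ {d} → d ∣ m → d ≢ m → d ∣ p ^ j
  proper-divisor {d} d∣m d≢m = prime-power-divisor p-prime j (subst (d ∣_) m≡pᵏ d∣m) (λ eq → d≢m (trans eq (sym m≡pᵏ)))

corollary4p9 : ∀ (n : ℕ) (σ : Permutation′ n) (m : ℕ) → GroupOrder σ m →
    (∃ λ p → ∃ λ k → Prime p × 1 ≤ k × m ≡ p ^ k) →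
    (InGR σ ⇔ (TwoBigOrbits σ ⊎ m ≡ 2))
corollary4p9 n σ zero (() , _) _
corollary4p9 n σ (suc m′) _ (p , zero , _ , () , _)
corollary4p9 n σ (suc m′) order@(_ , period , minimal) (p , suc j , p-prime , _ , m≡pᵏ)
  with regular-orbit σ j order p-prime m≡pᵏ
... | z , regular = mk⇔ necessary sufficient
  where
  open Action σ
  open Periodic σ m′ period

  1<m : 1 ℕ.< m
  1<m = subst (1 ℕ.<_) (sym m≡pᵏ) (^-monoʳ-< p (ℕ.nonTrivial⇒n>1 p {{prime⇒nonTrivial p-prime}}) {0} {suc j} (ℕ.s≤s ℕ.z≤n))

  σz≢z : 1 · z ≢ z
  σz≢z e = minimal 1 (ℕ.s≤s ℕ.z≤n) 1<m (regular 1 e)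

  σ²z≢z : m ≢ 2 → 2 · z ≢ z
  σ²z≢z m≢2 e = minimal 2 (ℕ.s≤s ℕ.z≤n) (≤∧≢⇒< 1<m (m≢2 ∘ sym)) (regular 2 e)

  necessary : InGR σ → TwoBigOrbits σ ⊎ m ≡ 2
  necessary gr with m ℕ.≟ 2
  ... | yes m≡2 = inj₂ m≡2
  ... | no m≢2 with second-big-orbit? z (σ²z≢z m≢2)
  ...   | inj₁ two = inj₁ two
  ...   | inj₂ one = ⊥-elim (not-GR regular (σ²z≢z m≢2) one gr)

  sufficient : TwoBigOrbits σ ⊎ m ≡ 2 → InGR σ
  sufficient = orbitalGraph-GR regular σz≢z ∘ criterion⇒rigidity σ²z≢z
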